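{- Let $\{a,b,c,d\} \subset \mathbb{Z}^2$ be an internal triangle (with $a,b,c,d$ its four distinct points in any order), and let $a_0, b_0, c_0, d_0 \in \mathbb{Z}^2$ satisfy $a_0 \equiv a$, $b_0 \equiv b$, $c_0 \equiv c$, $d_0 \equiv d$ modulo $4\mathbb{Z}^2$. Then $a_0 + b_0 + c_0 + d_0 \equiv 0 \pmod{4\mathbb{Z}^2}$ and $\det(b_0 - a_0, c_0 - a_0) \equiv \pm 1 \pmod 4$.
   Context: A lattice triangle is the convex hull in $\mathbb{R}^2$ of three non-collinear points of $\mathbb{Z}^2$. A triangle is a set $T = \Delta \cap \mathbb{Z}^2$ for a lattice triangle $\Delta$. An internal triangle is a triangle containing exactly $4$ points of $\mathbb{Z}^2$ whose non-vertex point lies in the interior of $\Delta$. For $u, v \in \mathbb{Z}^2$, $\det(u,v)$ denotes the determinant of the $2\times 2$ matrix with first column $u$ and second column $v$. -}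

module Defs where

open import Data.Integer using (ℤ; +_; _+_; _-_; _*_; _≤_; _<_)
open import Data.Integer.Divisibility using (_∣_)
open import Data.Product using (_×_; _,_; Σ; ∃; ∃-syntax)
open import Data.Sum using (_⊎_)
open import Relation.Binary.PropositionalEquality using (_≡_; _≢_)
open import Relation.Nullary using (¬_)

ℤ² : Set
ℤ² = ℤ × ℤ

_⊕_ : ℤ² → ℤ² → ℤ²
(x₁ , x₂) ⊕ (y₁ , y₂) = (x₁ + y₁ , x₂ + y₂)

_⊖_ : ℤ² → ℤ² → ℤ²
(x₁ , x₂) ⊖ (y₁ , y₂) = (x₁ - y₁ , x₂ - y₂)

_·_ : ℤ → ℤ² → ℤ²
k · (x₁ , x₂) = (k * x₁ , k * x₂)

det : ℤ² → ℤ² → ℤ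
det (u₁ , u₂) (v₁ , v₂) = u₁ * v₂ - v₁ * u₂

_≡₄_ : ℤ² → ℤ² → Set
(x₁ , x₂) ≡₄ (y₁ , y₂) = ((+ 4) ∣ (x₁ - y₁)) × ((+ 4) ∣ (x₂ - y₂))

NonCollinear : ℤ² → ℤ² → ℤ² → Set
NonCollinear p q r = det (q ⊖ p) (r ⊖ p) ≢ + 0

-- Since all points are rational,
-- the barycentric coordinates of x are rational; clearing denominators:
-- N·x = α·p + β·q + γ·r with α,β,γ ≥ 0, α+β+γ = N > 0.
InHull : ℤ² → ℤ² → ℤ² → ℤ² → Set
InHull p q r x =
  ∃[ N ] ∃[ α ] ∃[ β ] ∃[ γ ]
    (+ 0 < N) × (+ 0 ≤ α) × (+ 0 ≤ β) × (+ 0 ≤ γ) × (α + β + γ ≡ N)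
    × (N · x ≡ ((α · p) ⊕ (β · q)) ⊕ (γ · r))

InInterior : ℤ² → ℤ² → ℤ² → ℤ² → Set
InInterior p q r x =
  ∃[ N ] ∃[ α ] ∃[ β ] ∃[ γ ]
    (+ 0 < N) × (+ 0 < α) × (+ 0 < β) × (+ 0 < γ) × (α + β + γ ≡ N)
    × (N · x ≡ ((α · p) ⊕ (β · q)) ⊕ (γ · r))

In4 : ℤ² → ℤ² → ℤ² → ℤ² → ℤ² → Set
In4 a b c d x = (x ≡ a) ⊎ (x ≡ b) ⊎ (x ≡ c) ⊎ (x ≡ d)

Distinct4 : ℤ² → ℤ² → ℤ² → ℤ² → Set
Distinct4 a b c d =
  (a ≢ b) × (a ≢ c) × (a ≢ d) × (b ≢ c) × (b ≢ d) × (c ≢ d)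

-- {a,b,c,d} is an internal triangle: there is a lattice triangle
-- Δ = conv(p,q,r) (p,q,r ∈ ℤ² non-collinear) with Δ ∩ ℤ² = {a,b,c,d},
-- and the non-vertex point of {a,b,c,d} lies in the interior of Δ.
InternalTriangle : ℤ² → ℤ² → ℤ² → ℤ² → Set
InternalTriangle a b c d =
  Distinct4 a b c d ×
  ∃[ p ] ∃[ q ] ∃[ r ]
    NonCollinear p q r
    × (∀ x → InHull p q r x → In4 a b c d x)
    × (∀ x → In4 a b c d x → InHull p q r x)
    × (∀ x → In4 a b c d x → x ≢ p → x ≢ q → x ≢ r → InInterior p q r x)

{-# OPTIONS --safe #-}
-- Let p, q, r be the vertices of the triangle and e the fourth point, with barycentric
-- coordinates (α : β : γ), all positive. If α ≥ β + γ, the reflection 2e − p of e in p would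
-- be a lattice point of the triangle other than p, q, r, e; hence each coordinate is smaller
-- than the sum of the other two. Then p + q + r − 2e has positive coordinates, so it is a
-- lattice point of the triangle and must be e: e is the centroid, r = 3e − p − q, and the four
-- points sum to 4e. If δ = det(q − p, e − p) were even, then q − p, e − p or q − e would lie
-- in 2ℤ², and the corresponding midpoint would be a further lattice point of the triangle.
-- So δ is odd, and the determinant of any three of the four points, being ±δ or ±3δ, is odd,
-- hence ≡ ±1 (mod 4). Both conclusions only depend on the points modulo 4.
module Submission where

open import Defs
open import Data.Integer using (ℤ; +_; _+_; _-_)
open import Data.Integer.Divisibility using (_∣_)
open import Data.Product using (_×_; _,_)
open import Data.Sum using (_⊎_)

open import Data.Empty using (⊥; ⊥-elim)
open import Data.Integer using (-_; _*_; _<_; _≤_; _<?_; +<+; +≤+)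
open import Data.Integer.DivMod using (_/_; _%_)
import Data.Integer.DivMod as DivMod
import Data.Integer.Divisibility.Signed as Signed
import Data.Integer.Properties as ℤ
open import Data.Integer.Tactic.RingSolver using (solve-∀; solve)
open import Data.List using (_∷_; [])
import Data.Nat as ℕ
open import Data.Product using (∃-syntax; proj₁; proj₂)
open import Data.Product.Properties using (≡-dec)
open import Data.Sum using (inj₁; inj₂)
open import Function using (_∘_)
open import Relation.Binary.PropositionalEquality
  using (_≡_; _≢_; refl; sym; trans; cong; cong₂; subst; module ≡-Reasoning)
open import Relation.Nullary using (Dec; yes; no)

variable
  a b c d p q r e w x y : ℤ²
  N N′ α β γ α′ β′ γ′ : ℤ

0<+ : ∀ n → + 0 < + ℕ.suc n
0<+ n = +<+ (ℕ.s≤s ℕ.z≤n)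

0≤+ : ∀ n → + 0 ≤ + n
0≤+ n = +≤+ ℕ.z≤n

0<i⇒i≢0 : + 0 < N → N ≢ + 0
0<i⇒i≢0 0<N N≡0 = ℤ.<-irrefl (sym N≡0) 0<N

i<j⇒0<j-i : α < β → + 0 < β - α
i<j⇒0<j-i {α} {β} α<β = subst (_< β - α) (ℤ.+-inverseʳ α) (ℤ.+-monoˡ-< (- α) α<β)

1*i≡j*0⇒i≡0 : ∀ N → + 1 * α ≡ N * + 0 → α ≡ + 0
1*i≡j*0⇒i≡0 {α} N eq = trans (sym (ℤ.*-identityˡ α)) (trans eq (ℤ.*-zeroʳ N))

i*j≡0⇒i≡0 : ∀ s {D} → D ≢ + 0 → s * D ≡ + 0 → s ≡ + 0
i*j≡0⇒i≡0 s D≢0 sD≡0 with ℤ.i*j≡0⇒i≡0∨j≡0 s sD≡0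
... | inj₁ s≡0 = s≡0
... | inj₂ D≡0 = ⊥-elim (D≢0 D≡0)

i*[j+j]≢i*j : + 0 < N → + 0 < β → N * (β + β) ≢ N * β
i*[j+j]≢i*j {N} {β} 0<N 0<β N2β≡Nβ = 0<i⇒i≢0 0<β (i*j≡0⇒i≡0 β (0<i⇒i≢0 0<N) (begin
  β * N               ≡⟨ solve (β ∷ N ∷ []) ⟩
  N * (β + β) - N * β ≡⟨ cong (_- N * β) N2β≡Nβ ⟩
  N * β - N * β       ≡⟨ ℤ.+-inverseʳ (N * β) ⟩
  + 0                 ∎))
  where open ≡-Reasoning

-- Barycentric coordinates

record Bary (p q r : ℤ²) (N α β γ : ℤ) (x : ℤ²) : Set where
  constructor bary
  field
    weights : α + β + γ ≡ N
    combination : N · x ≡ ((α · p) ⊕ (β · q)) ⊕ (γ · r)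

Bary⇒InHull : + 0 < N → + 0 ≤ α → + 0 ≤ β → + 0 ≤ γ → Bary p q r N α β γ x → InHull p q r x
Bary⇒InHull 0<N 0≤α 0≤β 0≤γ (bary sum Nx) = _ , _ , _ , _ , 0<N , 0≤α , 0≤β , 0≤γ , sum , Nx

det≢0⇒independent : ∀ {u v s t} → det u v ≢ + 0 →
  (s · u) ⊕ (t · v) ≡ (+ 0 , + 0) → s ≡ + 0 × t ≡ + 0
det≢0⇒independent {u₁ , u₂} {v₁ , v₂} {s} {t} D≢0 su+tv≡0 =
  i*j≡0⇒i≡0 s D≢0 s*D≡0 , i*j≡0⇒i≡0 t D≢0 t*D≡0
  where
  open ≡-Reasoning
  s*D≡0 : s * det (u₁ , u₂) (v₁ , v₂) ≡ + 0
  s*D≡0 = begin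
    s * (u₁ * v₂ - v₁ * u₂)                              ≡⟨ solve (s ∷ t ∷ u₁ ∷ u₂ ∷ v₁ ∷ v₂ ∷ []) ⟩
    (s * u₁ + t * v₁) * v₂ - v₁ * (s * u₂ + t * v₂)      ≡⟨ cong (λ z → det z (v₁ , v₂)) su+tv≡0 ⟩
    + 0 * v₂ - v₁ * + 0                                  ≡⟨ solve (v₁ ∷ v₂ ∷ []) ⟩
    + 0                                                  ∎
  t*D≡0 : t * det (u₁ , u₂) (v₁ , v₂) ≡ + 0
  t*D≡0 = begin
    t * (u₁ * v₂ - v₁ * u₂)                              ≡⟨ solve (s ∷ t ∷ u₁ ∷ u₂ ∷ v₁ ∷ v₂ ∷ []) ⟩
    u₁ * (s * u₂ + t * v₂) - (s * u₁ + t * v₁) * u₂      ≡⟨ cong (det (u₁ , u₂)) su+tv≡0 ⟩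
    u₁ * + 0 - + 0 * u₂                                  ≡⟨ solve (u₁ ∷ u₂ ∷ []) ⟩
    + 0                                                  ∎

Bary-unique : NonCollinear p q r → Bary p q r N α β γ x → Bary p q r N′ α′ β′ γ′ x →
  N′ * α ≡ N * α′ × N′ * β ≡ N * β′ × N′ * γ ≡ N * γ′
Bary-unique {α = α} {β} {γ} {α′ = α′} {β′} {γ′} nc (bary refl Nx) (bary refl N′x) =
  ℤ.i-j≡0⇒i≡j _ _ α-part , ℤ.i-j≡0⇒i≡j _ _ β-part , ℤ.i-j≡0⇒i≡j _ _ γ-part
  where
  open ≡-Reasoning
  vanishes : ∀ {p q r x} →
    (α + β + γ) * x ≡ α * p + β * q + γ * r → (α′ + β′ + γ′) * x ≡ α′ * p + β′ * q + γ′ * r →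
    ((α′ + β′ + γ′) * β - (α + β + γ) * β′) * (q - p) +
    ((α′ + β′ + γ′) * γ - (α + β + γ) * γ′) * (r - p) ≡ + 0
  vanishes {p} {q} {r} {x} Nx N′x = begin
    ((α′ + β′ + γ′) * β - (α + β + γ) * β′) * (q - p) +
    ((α′ + β′ + γ′) * γ - (α + β + γ) * γ′) * (r - p)
      ≡⟨ solve (α ∷ β ∷ γ ∷ α′ ∷ β′ ∷ γ′ ∷ p ∷ q ∷ r ∷ []) ⟩
    (α′ + β′ + γ′) * (α * p + β * q + γ * r) - (α + β + γ) * (α′ * p + β′ * q + γ′ * r)
      ≡⟨ cong₂ (λ s t → (α′ + β′ + γ′) * s - (α + β + γ) * t) (sym Nx) (sym N′x) ⟩
    (α′ + β′ + γ′) * ((α + β + γ) * x) - (α + β + γ) * ((α′ + β′ + γ′) * x)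
      ≡⟨ solve (α ∷ β ∷ γ ∷ α′ ∷ β′ ∷ γ′ ∷ x ∷ []) ⟩
    + 0 ∎
  βγ-parts : ((α′ + β′ + γ′) * β - (α + β + γ) * β′ ≡ + 0) ×
             ((α′ + β′ + γ′) * γ - (α + β + γ) * γ′ ≡ + 0)
  βγ-parts = det≢0⇒independent nc (cong₂ _,_ (vanishes (cong proj₁ Nx) (cong proj₁ N′x))
                                             (vanishes (cong proj₂ Nx) (cong proj₂ N′x)))
  β-part : (α′ + β′ + γ′) * β - (α + β + γ) * β′ ≡ + 0
  β-part = proj₁ βγ-parts
  γ-part : (α′ + β′ + γ′) * γ - (α + β + γ) * γ′ ≡ + 0
  γ-part = proj₂ βγ-parts
  α-part : (α′ + β′ + γ′) * α - (α + β + γ) * α′ ≡ + 0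
  α-part = begin
    (α′ + β′ + γ′) * α - (α + β + γ) * α′
      ≡⟨ solve (α ∷ β ∷ γ ∷ α′ ∷ β′ ∷ γ′ ∷ []) ⟩
    - (((α′ + β′ + γ′) * β - (α + β + γ) * β′) + ((α′ + β′ + γ′) * γ - (α + β + γ) * γ′))
      ≡⟨ cong₂ (λ s t → - (s + t)) β-part γ-part ⟩
    + 0 ∎

Bary-vertex₁ : Bary p q r (+ 1) (+ 1) (+ 0) (+ 0) p
Bary-vertex₁ {p₁ , p₂} {q₁ , q₂} {r₁ , r₂} = bary refl (cong₂ _,_ (unit p₁ q₁ r₁) (unit p₂ q₂ r₂))
  where
  unit : ∀ p q r → + 1 * p ≡ + 1 * p + + 0 * q + + 0 * r
  unit = solve-∀

Bary-vertex₂ : Bary p q r (+ 1) (+ 0) (+ 1) (+ 0) q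
Bary-vertex₂ {p₁ , p₂} {q₁ , q₂} {r₁ , r₂} = bary refl (cong₂ _,_ (unit p₁ q₁ r₁) (unit p₂ q₂ r₂))
  where
  unit : ∀ p q r → + 1 * q ≡ + 0 * p + + 1 * q + + 0 * r
  unit = solve-∀

Bary-vertex₃ : Bary p q r (+ 1) (+ 0) (+ 0) (+ 1) r
Bary-vertex₃ {p₁ , p₂} {q₁ , q₂} {r₁ , r₂} = bary refl (cong₂ _,_ (unit p₁ q₁ r₁) (unit p₂ q₂ r₂))
  where
  unit : ∀ p q r → + 1 * r ≡ + 0 * p + + 0 * q + + 1 * r
  unit = solve-∀

InHull-vertex₁ : InHull p q r p
InHull-vertex₁ = Bary⇒InHull (0<+ 0) (0≤+ 1) (0≤+ 0) (0≤+ 0) Bary-vertex₁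

InHull-vertex₂ : InHull p q r q
InHull-vertex₂ = Bary⇒InHull (0<+ 0) (0≤+ 0) (0≤+ 1) (0≤+ 0) Bary-vertex₂

InHull-vertex₃ : InHull p q r r
InHull-vertex₃ = Bary⇒InHull (0<+ 0) (0≤+ 0) (0≤+ 0) (0≤+ 1) Bary-vertex₃

Bary-at-vertex₁ : NonCollinear p q r → Bary p q r N α β γ p → β ≡ + 0 × γ ≡ + 0
Bary-at-vertex₁ {N = N} nc b with Bary-unique nc b Bary-vertex₁
... | _ , β≡0 , γ≡0 = 1*i≡j*0⇒i≡0 N β≡0 , 1*i≡j*0⇒i≡0 N γ≡0

Bary-at-vertex₂ : NonCollinear p q r → Bary p q r N α β γ q → α ≡ + 0 × γ ≡ + 0
Bary-at-vertex₂ {N = N} nc b with Bary-unique nc b Bary-vertex₂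
... | α≡0 , _ , γ≡0 = 1*i≡j*0⇒i≡0 N α≡0 , 1*i≡j*0⇒i≡0 N γ≡0

Bary-at-vertex₃ : NonCollinear p q r → Bary p q r N α β γ r → α ≡ + 0 × β ≡ + 0
Bary-at-vertex₃ {N = N} nc b with Bary-unique nc b Bary-vertex₃
... | α≡0 , β≡0 , _ = 1*i≡j*0⇒i≡0 N α≡0 , 1*i≡j*0⇒i≡0 N β≡0

Bary-rotate : Bary p q r N α β γ x → Bary q r p N β γ α x
Bary-rotate {p₁ , p₂} {q₁ , q₂} {r₁ , r₂} {α = α} {β} {γ} (bary sum Nx) =
  bary (trans (sym (rotate α β γ)) sum)
       (trans Nx (cong₂ _,_ (rotate (α * p₁) (β * q₁) (γ * r₁))
                            (rotate (α * p₂) (β * q₂) (γ * r₂))))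
  where
  rotate : ∀ a b c → a + b + c ≡ b + c + a
  rotate = solve-∀

InHull-rotate : InHull p q r x → InHull q r p x
InHull-rotate {p} {q} {r} {x} (N , α , β , γ , 0<N , 0≤α , 0≤β , 0≤γ , sum , Nx) =
  Bary⇒InHull 0<N 0≤β 0≤γ 0≤α (Bary-rotate (bary {p} {q} {r} {N} {α} {β} {γ} {x} sum Nx))

InInterior-rotate : InInterior p q r x → InInterior q r p x
InInterior-rotate {p} {q} {r} {x} (N , α , β , γ , 0<N , 0<α , 0<β , 0<γ , sum , Nx)
  with Bary-rotate (bary {p} {q} {r} {N} {α} {β} {γ} {x} sum Nx)
... | bary sum′ Nx′ = _ , _ , _ , _ , 0<N , 0<β , 0<γ , 0<α , sum′ , Nx′

NonCollinear-rotate : NonCollinear p q r → NonCollinear q r p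
NonCollinear-rotate {p₁ , p₂} {q₁ , q₂} {r₁ , r₂} nc D≡0 = nc (trans (rotate p₁ p₂ q₁ q₂ r₁ r₂) D≡0)
  where
  rotate : ∀ p₁ p₂ q₁ q₂ r₁ r₂ →
    (q₁ - p₁) * (r₂ - p₂) - (r₁ - p₁) * (q₂ - p₂) ≡ (r₁ - q₁) * (p₂ - q₂) - (p₁ - q₁) * (r₂ - q₂)
  rotate = solve-∀

NonCollinear⇒p≢q : NonCollinear p q r → p ≢ q
NonCollinear⇒p≢q {p₁ , p₂} {r = r₁ , r₂} nc refl = nc (degenerate p₁ p₂ r₁ r₂)
  where
  degenerate : ∀ p₁ p₂ r₁ r₂ → (p₁ - p₁) * (r₂ - p₂) - (r₁ - p₁) * (p₂ - p₂) ≡ + 0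
  degenerate = solve-∀

NonCollinear⇒p≢r : NonCollinear p q r → p ≢ r
NonCollinear⇒p≢r {p₁ , p₂} {q₁ , q₂} nc refl = nc (degenerate p₁ p₂ q₁ q₂)
  where
  degenerate : ∀ p₁ p₂ q₁ q₂ → (q₁ - p₁) * (p₂ - p₂) - (p₁ - p₁) * (q₂ - p₂) ≡ + 0
  degenerate = solve-∀

NonCollinear⇒q≢r : NonCollinear p q r → q ≢ r
NonCollinear⇒q≢r {p₁ , p₂} {q₁ , q₂} nc refl = nc (degenerate p₁ p₂ q₁ q₂)
  where
  degenerate : ∀ p₁ p₂ q₁ q₂ → (q₁ - p₁) * (q₂ - p₂) - (q₁ - p₁) * (q₂ - p₂) ≡ + 0
  degenerate = solve-∀

-- Triangles with a single extra lattice point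

record OnlyLatticePoint (p q r e : ℤ²) : Set where
  field
    nonCollinear : NonCollinear p q r
    latticePoints : ∀ x → InHull p q r x → In4 p q r e x
    interior : InInterior p q r e

OnlyLatticePoint-rotate : OnlyLatticePoint p q r e → OnlyLatticePoint q r p e
OnlyLatticePoint-rotate {p} {q} {r} {e} t = record
  { nonCollinear = NonCollinear-rotate {p} {q} {r} nonCollinear
  ; latticePoints = λ x x∈qrp → rotate (latticePoints x (InHull-rotate (InHull-rotate x∈qrp)))
  ; interior = InInterior-rotate interior
  }
  where
  open OnlyLatticePoint t
  rotate : In4 p q r e x → In4 q r p e x
  rotate (inj₁ x≡p) = inj₂ (inj₂ (inj₁ x≡p))
  rotate (inj₂ (inj₁ x≡q)) = inj₁ x≡q
  rotate (inj₂ (inj₂ (inj₁ x≡r))) = inj₂ (inj₁ x≡r)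
  rotate (inj₂ (inj₂ (inj₂ x≡e))) = inj₂ (inj₂ (inj₂ x≡e))

lattice-point : OnlyLatticePoint p q r e →
  + 0 < N → + 0 ≤ α → + 0 ≤ β → + 0 ≤ γ → Bary p q r N α β γ y →
  (β ≡ + 0 × γ ≡ + 0) ⊎ (α ≡ + 0 × γ ≡ + 0) ⊎ (α ≡ + 0 × β ≡ + 0) ⊎ y ≡ e
lattice-point {y = y} t 0<N 0≤α 0≤β 0≤γ b
  with OnlyLatticePoint.latticePoints t y (Bary⇒InHull 0<N 0≤α 0≤β 0≤γ b)
... | inj₁ refl = inj₁ (Bary-at-vertex₁ (OnlyLatticePoint.nonCollinear t) b)
... | inj₂ (inj₁ refl) = inj₂ (inj₁ (Bary-at-vertex₂ (OnlyLatticePoint.nonCollinear t) b))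
... | inj₂ (inj₂ (inj₁ refl)) =
  inj₂ (inj₂ (inj₁ (Bary-at-vertex₃ (OnlyLatticePoint.nonCollinear t) b)))
... | inj₂ (inj₂ (inj₂ y≡e)) = inj₂ (inj₂ (inj₂ y≡e))

lattice-point-coords : OnlyLatticePoint p q r e → Bary p q r N′ α′ β′ γ′ e →
  + 0 < N → + 0 ≤ α → + 0 ≤ β → + 0 ≤ γ → Bary p q r N α β γ y →
  (β ≡ + 0 × γ ≡ + 0) ⊎ (α ≡ + 0 × γ ≡ + 0) ⊎ (α ≡ + 0 × β ≡ + 0) ⊎
  (N′ * α ≡ N * α′ × N′ * β ≡ N * β′ × N′ * γ ≡ N * γ′)
lattice-point-coords t bₑ 0<N 0≤α 0≤β 0≤γ b with lattice-point t 0<N 0≤α 0≤β 0≤γ b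
... | inj₁ at-p = inj₁ at-p
... | inj₂ (inj₁ at-q) = inj₂ (inj₁ at-q)
... | inj₂ (inj₂ (inj₁ at-r)) = inj₂ (inj₂ (inj₁ at-r))
... | inj₂ (inj₂ (inj₂ refl)) =
  inj₂ (inj₂ (inj₂ (Bary-unique (OnlyLatticePoint.nonCollinear t) b bₑ)))

not-a-lattice-point : OnlyLatticePoint p q r e → Bary p q r N′ α′ β′ γ′ e →
  + 0 < N → + 0 ≤ α → + 0 ≤ β → + 0 ≤ γ → Bary p q r N α β γ y →
  α ≢ + 0 → β ≢ + 0 → N′ * α ≢ N * α′ → ⊥
not-a-lattice-point t bₑ 0<N 0≤α 0≤β 0≤γ b α≢0 β≢0 ≢e
  with lattice-point-coords t bₑ 0<N 0≤α 0≤β 0≤γ b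
... | inj₁ (β≡0 , _) = β≢0 β≡0
... | inj₂ (inj₁ (α≡0 , _)) = α≢0 α≡0
... | inj₂ (inj₂ (inj₁ (α≡0 , _))) = α≢0 α≡0
... | inj₂ (inj₂ (inj₂ (≡e , _))) = ≢e ≡e

-- The centroid

Bary-reflect : Bary p q r N α β γ e → Bary p q r N (α - (β + γ)) (β + β) (γ + γ) (((+ 2) · e) ⊖ p)
Bary-reflect {α = α} {β} {γ} (bary refl Ne) =
  bary (solve (α ∷ β ∷ γ ∷ [])) (cong₂ _,_ (reflect (cong proj₁ Ne)) (reflect (cong proj₂ Ne)))
  where
  open ≡-Reasoning
  reflect : ∀ {e p q r} → (α + β + γ) * e ≡ α * p + β * q + γ * r →
    (α + β + γ) * (+ 2 * e - p) ≡ (α - (β + γ)) * p + (β + β) * q + (γ + γ) * r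
  reflect {e} {p} {q} {r} Ne = begin
    (α + β + γ) * (+ 2 * e - p)
      ≡⟨ solve (α ∷ β ∷ γ ∷ e ∷ p ∷ []) ⟩
    + 2 * ((α + β + γ) * e) - (α + β + γ) * p
      ≡⟨ cong (λ t → + 2 * t - (α + β + γ) * p) Ne ⟩
    + 2 * (α * p + β * q + γ * r) - (α + β + γ) * p
      ≡⟨ solve (α ∷ β ∷ γ ∷ p ∷ q ∷ r ∷ []) ⟩
    (α - (β + γ)) * p + (β + β) * q + (γ + γ) * r ∎

-- Otherwise the reflection 2e − p of e in p would be a further lattice point of the triangle.
coordinate-bound : OnlyLatticePoint p q r e → Bary p q r N α β γ e →
  + 0 < N → + 0 < β → + 0 < γ → α < β + γ
coordinate-bound {α = α} {β} {γ} t b 0<N 0<β 0<γ with α <? β + γ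
... | yes α<β+γ = α<β+γ
... | no α≮β+γ
  with lattice-point-coords t b 0<N (ℤ.i≤j⇒0≤j-i (ℤ.≮⇒≥ α≮β+γ))
         (ℤ.<⇒≤ (ℤ.+-mono-< 0<β 0<β)) (ℤ.<⇒≤ (ℤ.+-mono-< 0<γ 0<γ)) (Bary-reflect b)
...   | inj₁ (2β≡0 , _) = ⊥-elim (0<i⇒i≢0 (ℤ.+-mono-< 0<β 0<β) 2β≡0)
...   | inj₂ (inj₁ (_ , 2γ≡0)) = ⊥-elim (0<i⇒i≢0 (ℤ.+-mono-< 0<γ 0<γ) 2γ≡0)
...   | inj₂ (inj₂ (inj₁ (_ , 2β≡0))) = ⊥-elim (0<i⇒i≢0 (ℤ.+-mono-< 0<β 0<β) 2β≡0)
...   | inj₂ (inj₂ (inj₂ (_ , N2β≡Nβ , _))) = ⊥-elim (i*[j+j]≢i*j 0<N 0<β N2β≡Nβ)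

Bary-opposite : Bary p q r N α β γ e →
  Bary p q r N (β + γ - α) (γ + α - β) (α + β - γ) (((p ⊕ q) ⊕ r) ⊖ ((+ 2) · e))
Bary-opposite {α = α} {β} {γ} (bary refl Ne) =
  bary (solve (α ∷ β ∷ γ ∷ [])) (cong₂ _,_ (opposite (cong proj₁ Ne)) (opposite (cong proj₂ Ne)))
  where
  open ≡-Reasoning
  opposite : ∀ {e p q r} → (α + β + γ) * e ≡ α * p + β * q + γ * r →
    (α + β + γ) * (p + q + r - + 2 * e) ≡ (β + γ - α) * p + (γ + α - β) * q + (α + β - γ) * r
  opposite {e} {p} {q} {r} Ne = begin
    (α + β + γ) * (p + q + r - + 2 * e)
      ≡⟨ solve (α ∷ β ∷ γ ∷ e ∷ p ∷ q ∷ r ∷ []) ⟩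
    (α + β + γ) * (p + q + r) - + 2 * ((α + β + γ) * e)
      ≡⟨ cong (λ t → (α + β + γ) * (p + q + r) - + 2 * t) Ne ⟩
    (α + β + γ) * (p + q + r) - + 2 * (α * p + β * q + γ * r)
      ≡⟨ solve (α ∷ β ∷ γ ∷ p ∷ q ∷ r ∷ []) ⟩
    (β + γ - α) * p + (γ + α - β) * q + (α + β - γ) * r ∎

-- The third vertex of the triangle with vertices p, q and centroid e.
apex : ℤ² → ℤ² → ℤ² → ℤ²
apex p q e = (((+ 3) · e) ⊖ p) ⊖ q

opposite≡e⇒apex : ((p ⊕ q) ⊕ r) ⊖ ((+ 2) · e) ≡ e → r ≡ apex p q e
opposite≡e⇒apex {p₁ , p₂} {q₁ , q₂} {r₁ , r₂} {e₁ , e₂} eq =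
  cong₂ _,_ (solve-r (cong proj₁ eq)) (solve-r (cong proj₂ eq))
  where
  open ≡-Reasoning
  solve-r : ∀ {p q r e} → p + q + r - + 2 * e ≡ e → r ≡ + 3 * e - p - q
  solve-r {p} {q} {r} {e} eq = begin
    r                                       ≡⟨ solve (p ∷ q ∷ r ∷ e ∷ []) ⟩
    (p + q + r - + 2 * e) + + 2 * e - p - q ≡⟨ cong (λ t → t + + 2 * e - p - q) eq ⟩
    e + + 2 * e - p - q                     ≡⟨ solve (p ∷ q ∷ e ∷ []) ⟩
    + 3 * e - p - q                         ∎

opposite-positive⇒centroid : OnlyLatticePoint p q r e → Bary p q r N α β γ e → + 0 < N →
  + 0 < β + γ - α → + 0 < γ + α - β → + 0 < α + β - γ → r ≡ apex p q e
opposite-positive⇒centroid t b 0<N 0<α′ 0<β′ 0<γ′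
  with lattice-point t 0<N (ℤ.<⇒≤ 0<α′) (ℤ.<⇒≤ 0<β′) (ℤ.<⇒≤ 0<γ′) (Bary-opposite b)
... | inj₁ (β′≡0 , _) = ⊥-elim (0<i⇒i≢0 0<β′ β′≡0)
... | inj₂ (inj₁ (α′≡0 , _)) = ⊥-elim (0<i⇒i≢0 0<α′ α′≡0)
... | inj₂ (inj₂ (inj₁ (α′≡0 , _))) = ⊥-elim (0<i⇒i≢0 0<α′ α′≡0)
... | inj₂ (inj₂ (inj₂ opposite≡e)) = opposite≡e⇒apex opposite≡e

centroid : OnlyLatticePoint p q r e → r ≡ apex p q e
centroid {p} {q} {r} {e} t with OnlyLatticePoint.interior t
... | N , α , β , γ , 0<N , 0<α , 0<β , 0<γ , sum , Ne = opposite-positive⇒centroid t bₑ 0<N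
  (i<j⇒0<j-i (coordinate-bound t bₑ 0<N 0<β 0<γ))
  (i<j⇒0<j-i (coordinate-bound t′ (Bary-rotate bₑ) 0<N 0<γ 0<α))
  (i<j⇒0<j-i (coordinate-bound t″ (Bary-rotate (Bary-rotate bₑ)) 0<N 0<α 0<β))
  where
  bₑ : Bary p q r N α β γ e
  bₑ = bary sum Ne
  t′ : OnlyLatticePoint q r p e
  t′ = OnlyLatticePoint-rotate t
  t″ : OnlyLatticePoint r p q e
  t″ = OnlyLatticePoint-rotate t′

-- Parity

Odd : ℤ → Set
Odd x = ∃[ k ] x ≡ + 2 * k + + 1

Even² : ℤ² → Set
Even² w = ∃[ k ] w ≡ (+ 2) · k

_≡₂_ : ℤ² → ℤ² → Set
x ≡₂ y = ∃[ k ] x ≡ y ⊕ ((+ 2) · k)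

Bit : ℤ → Set
Bit b = b ≡ + 0 ⊎ b ≡ + 1

parity : ∀ x → ∃[ k ] ∃[ b ] Bit b × x ≡ + 2 * k + b
parity x with x % + 2 | DivMod.n%d<d x (+ 2) | DivMod.a≡a%n+[a/n]*n x (+ 2)
... | 0 | _ | x≡ = x / + 2 , + 0 , inj₁ refl , trans x≡ (even (x / + 2))
  where
  even : ∀ k → + 0 + k * + 2 ≡ + 2 * k + + 0
  even = solve-∀
... | 1 | _ | x≡ = x / + 2 , + 1 , inj₂ refl , trans x≡ (odd (x / + 2))
  where
  odd : ∀ k → + 1 + k * + 2 ≡ + 2 * k + + 1
  odd = solve-∀
... | ℕ.suc (ℕ.suc _) | ℕ.s≤s (ℕ.s≤s ()) | _

Odd-+-even : ∀ w {o o′} → o′ ≡ + 2 * w + o → Odd o → Odd o′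
Odd-+-even w refl (k , refl) = w + k , shift w k
  where
  shift : ∀ w k → + 2 * w + (+ 2 * k + + 1) ≡ + 2 * (w + k) + + 1
  shift = solve-∀

Odd-neg : ∀ {o} → Odd o → Odd (- o)
Odd-neg (k , refl) = - k - + 1 , negate k
  where
  negate : ∀ k → - (+ 2 * k + + 1) ≡ + 2 * (- k - + 1) + + 1
  negate = solve-∀

Odd-* : ∀ {o o′} → Odd o → Odd o′ → Odd (o * o′)
Odd-* (k , refl) (l , refl) = + 2 * k * l + k + l , multiply k l
  where
  multiply : ∀ k l → (+ 2 * k + + 1) * (+ 2 * l + + 1) ≡ + 2 * (+ 2 * k * l + k + l) + + 1
  multiply = solve-∀

-- Over 𝔽₂, two vectors form a basis unless one of them is zero or they are equal.
residues : ∀ {ε₁ ε₂ η₁ η₂} → Bit ε₁ → Bit ε₂ → Bit η₁ → Bit η₂ →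
  Odd (ε₁ * η₂ - η₁ * ε₂) ⊎ (ε₁ ≡ + 0 × ε₂ ≡ + 0) ⊎ (η₁ ≡ + 0 × η₂ ≡ + 0) ⊎ (ε₁ ≡ η₁ × ε₂ ≡ η₂)
residues (inj₁ refl) (inj₁ refl) _           _           = inj₂ (inj₁ (refl , refl))
residues _           _           (inj₁ refl) (inj₁ refl) = inj₂ (inj₂ (inj₁ (refl , refl)))
residues (inj₁ refl) (inj₂ refl) (inj₁ refl) (inj₂ refl) = inj₂ (inj₂ (inj₂ (refl , refl)))
residues (inj₂ refl) (inj₁ refl) (inj₂ refl) (inj₁ refl) = inj₂ (inj₂ (inj₂ (refl , refl)))
residues (inj₂ refl) (inj₂ refl) (inj₂ refl) (inj₂ refl) = inj₂ (inj₂ (inj₂ (refl , refl)))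
residues (inj₁ refl) (inj₂ refl) (inj₂ refl) (inj₁ refl) = inj₁ (- + 1 , refl)
residues (inj₁ refl) (inj₂ refl) (inj₂ refl) (inj₂ refl) = inj₁ (- + 1 , refl)
residues (inj₂ refl) (inj₁ refl) (inj₁ refl) (inj₂ refl) = inj₁ (+ 0 , refl)
residues (inj₂ refl) (inj₁ refl) (inj₂ refl) (inj₂ refl) = inj₁ (+ 0 , refl)
residues (inj₂ refl) (inj₂ refl) (inj₁ refl) (inj₂ refl) = inj₁ (+ 0 , refl)
residues (inj₂ refl) (inj₂ refl) (inj₂ refl) (inj₁ refl) = inj₁ (- + 1 , refl)

det-parity : ∀ u v → Odd (det u v) ⊎ Even² u ⊎ Even² v ⊎ Even² (u ⊖ v)
det-parity (u₁ , u₂) (v₁ , v₂)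
  with parity u₁ | parity u₂ | parity v₁ | parity v₂
... | U₁ , ε₁ , bε₁ , refl | U₂ , ε₂ , bε₂ , refl | V₁ , η₁ , bη₁ , refl | V₂ , η₂ , bη₂ , refl
  with residues bε₁ bε₂ bη₁ bη₂
... | inj₁ odd = inj₁ (Odd-+-even W (expand U₁ U₂ V₁ V₂ ε₁ ε₂ η₁ η₂) odd)
  where
  W : ℤ
  W = + 2 * (U₁ * V₂ - V₁ * U₂) + U₁ * η₂ + ε₁ * V₂ - V₁ * ε₂ - η₁ * U₂
  expand : ∀ U₁ U₂ V₁ V₂ ε₁ ε₂ η₁ η₂ →
    (+ 2 * U₁ + ε₁) * (+ 2 * V₂ + η₂) - (+ 2 * V₁ + η₁) * (+ 2 * U₂ + ε₂) ≡
    + 2 * (+ 2 * (U₁ * V₂ - V₁ * U₂) + U₁ * η₂ + ε₁ * V₂ - V₁ * ε₂ - η₁ * U₂) + (ε₁ * η₂ - η₁ * ε₂)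
  expand = solve-∀
... | inj₂ (inj₁ (refl , refl)) =
  inj₂ (inj₁ ((U₁ , U₂) , cong₂ _,_ (ℤ.+-identityʳ _) (ℤ.+-identityʳ _)))
... | inj₂ (inj₂ (inj₁ (refl , refl))) =
  inj₂ (inj₂ (inj₁ ((V₁ , V₂) , cong₂ _,_ (ℤ.+-identityʳ _) (ℤ.+-identityʳ _))))
... | inj₂ (inj₂ (inj₂ (refl , refl))) =
  inj₂ (inj₂ (inj₂ ((U₁ - V₁ , U₂ - V₂) , cong₂ _,_ (cancel U₁ V₁ ε₁) (cancel U₂ V₂ ε₂))))
  where
  cancel : ∀ U V ε → + 2 * U + ε - (+ 2 * V + ε) ≡ + 2 * (U - V)
  cancel = solve-∀

Even²-⊖ : Even² (x ⊖ y) → x ≡₂ y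
Even²-⊖ {x₁ , x₂} {y₁ , y₂} (k , x-y≡2k) =
  k , cong₂ _,_ (shift (cong proj₁ x-y≡2k)) (shift (cong proj₂ x-y≡2k))
  where
  open ≡-Reasoning
  shift : ∀ {x y k} → x - y ≡ k → x ≡ y + k
  shift {x} {y} {k} x-y≡k = begin
    x             ≡⟨ solve (x ∷ y ∷ []) ⟩
    y + (x - y)   ≡⟨ cong (λ t → y + t) x-y≡k ⟩
    y + k         ∎

⊖-⊖-cancel : ∀ p q e → (q ⊖ p) ⊖ (e ⊖ p) ≡ q ⊖ e
⊖-⊖-cancel (p₁ , p₂) (q₁ , q₂) (e₁ , e₂) = cong₂ _,_ (cancel p₁ q₁ e₁) (cancel p₂ q₂ e₂)
  where
  cancel : ∀ p q e → (q - p) - (e - p) ≡ q - e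
  cancel = solve-∀

area-parity : ∀ p q e → Odd (det (q ⊖ p) (e ⊖ p)) ⊎ q ≡₂ p ⊎ e ≡₂ p ⊎ q ≡₂ e
area-parity p q e with det-parity (q ⊖ p) (e ⊖ p)
... | inj₁ odd = inj₁ odd
... | inj₂ (inj₁ q-p-even) = inj₂ (inj₁ (Even²-⊖ q-p-even))
... | inj₂ (inj₂ (inj₁ e-p-even)) = inj₂ (inj₂ (inj₁ (Even²-⊖ e-p-even)))
... | inj₂ (inj₂ (inj₂ (k , eq))) =
  inj₂ (inj₂ (inj₂ (Even²-⊖ (k , trans (sym (⊖-⊖-cancel p q e)) eq))))

Bary-centroid : Bary p q (apex p q e) (+ 3) (+ 1) (+ 1) (+ 1) e
Bary-centroid {p₁ , p₂} {q₁ , q₂} {e₁ , e₂} =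
  bary refl (cong₂ _,_ (centre p₁ q₁ e₁) (centre p₂ q₂ e₂))
  where
  centre : ∀ p q e → + 3 * e ≡ + 1 * p + + 1 * q + + 1 * (+ 3 * e - p - q)
  centre = solve-∀

Bary-midpoint : ∀ k → Bary p (p ⊕ ((+ 2) · k)) r (+ 2) (+ 1) (+ 1) (+ 0) (p ⊕ k)
Bary-midpoint {p₁ , p₂} {r₁ , r₂} (k₁ , k₂) =
  bary refl (cong₂ _,_ (mid p₁ r₁ k₁) (mid p₂ r₂ k₂))
  where
  mid : ∀ p r k → + 2 * (p + k) ≡ + 1 * p + + 1 * (p + + 2 * k) + + 0 * r
  mid = solve-∀

Bary-midpoint-vertex₁-centroid : ∀ k →
  Bary p q (apex p q (p ⊕ ((+ 2) · k))) (+ 6) (+ 4) (+ 1) (+ 1) (p ⊕ k)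
Bary-midpoint-vertex₁-centroid {p₁ , p₂} {q₁ , q₂} (k₁ , k₂) =
  bary refl (cong₂ _,_ (mid p₁ q₁ k₁) (mid p₂ q₂ k₂))
  where
  mid : ∀ p q k → + 6 * (p + k) ≡ + 4 * p + + 1 * q + + 1 * (+ 3 * (p + + 2 * k) - p - q)
  mid = solve-∀

Bary-midpoint-vertex₂-centroid : ∀ k →
  Bary p (e ⊕ ((+ 2) · k)) (apex p (e ⊕ ((+ 2) · k)) e) (+ 6) (+ 1) (+ 4) (+ 1) (e ⊕ k)
Bary-midpoint-vertex₂-centroid {p₁ , p₂} {e₁ , e₂} (k₁ , k₂) =
  bary refl (cong₂ _,_ (mid p₁ e₁ k₁) (mid p₂ e₂ k₂))
  where
  mid : ∀ p e k →
    + 6 * (e + k) ≡ + 1 * p + + 4 * (e + + 2 * k) + + 1 * (+ 3 * e - p - (e + + 2 * k))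
  mid = solve-∀

-- Otherwise the midpoint of two of p, q, e would be a further lattice point of the triangle.
area-odd : OnlyLatticePoint p q (apex p q e) e → Odd (det (q ⊖ p) (e ⊖ p))
area-odd {p} {q} {e} t with area-parity p q e
... | inj₁ odd = odd
... | inj₂ (inj₁ (k , refl)) = ⊥-elim (not-a-lattice-point t Bary-centroid
  (0<+ 1) (0≤+ 1) (0≤+ 1) (0≤+ 0) (Bary-midpoint k) (λ ()) (λ ()) (λ ()))
... | inj₂ (inj₂ (inj₁ (k , refl))) = ⊥-elim (not-a-lattice-point t Bary-centroid
  (0<+ 5) (0≤+ 4) (0≤+ 1) (0≤+ 1) (Bary-midpoint-vertex₁-centroid k) (λ ()) (λ ()) (λ ()))
... | inj₂ (inj₂ (inj₂ (k , refl))) = ⊥-elim (not-a-lattice-point t Bary-centroid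
  (0<+ 5) (0≤+ 1) (0≤+ 4) (0≤+ 1) (Bary-midpoint-vertex₂-centroid {p} {e} k) (λ ()) (λ ()) (λ ()))

-- The four points in any order

record ZeroSumOddArea (a b c d : ℤ²) : Set where
  constructor ⟨_,_⟩
  field
    zero-sum : (((a ⊕ b) ⊕ c) ⊕ d) ≡₄ (+ 0 , + 0)
    odd-area : Odd (det (b ⊖ a) (c ⊖ a))

divides-by : ∀ k {z} → z ≡ k * + 4 → + 4 ∣ z
divides-by k z≡k*4 = Signed.∣⇒∣ᵤ (Signed.divides k z≡k*4)

ZeroSumOddArea-swap₁₂ : ZeroSumOddArea a b c d → ZeroSumOddArea b a c d
ZeroSumOddArea-swap₁₂ {a₁ , a₂} {b₁ , b₂} {c₁ , c₂} {d₁ , d₂} ⟨ zero-sum , odd-area ⟩ = ⟨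
  subst (_≡₄ (+ 0 , + 0)) (cong₂ _,_ (swap a₁ b₁ c₁ d₁) (swap a₂ b₂ c₂ d₂)) zero-sum ,
  subst Odd (sym (antisymmetric a₁ a₂ b₁ b₂ c₁ c₂)) (Odd-neg odd-area) ⟩
  where
  swap : ∀ a b c d → a + b + c + d ≡ b + a + c + d
  swap = solve-∀
  antisymmetric : ∀ a₁ a₂ b₁ b₂ c₁ c₂ →
    (a₁ - b₁) * (c₂ - b₂) - (c₁ - b₁) * (a₂ - b₂) ≡
    - ((b₁ - a₁) * (c₂ - a₂) - (c₁ - a₁) * (b₂ - a₂))
  antisymmetric = solve-∀

ZeroSumOddArea-swap₂₃ : ZeroSumOddArea a b c d → ZeroSumOddArea a c b d
ZeroSumOddArea-swap₂₃ {a₁ , a₂} {b₁ , b₂} {c₁ , c₂} {d₁ , d₂} ⟨ zero-sum , odd-area ⟩ = ⟨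
  subst (_≡₄ (+ 0 , + 0)) (cong₂ _,_ (swap a₁ b₁ c₁ d₁) (swap a₂ b₂ c₂ d₂)) zero-sum ,
  subst Odd (sym (antisymmetric a₁ a₂ b₁ b₂ c₁ c₂)) (Odd-neg odd-area) ⟩
  where
  swap : ∀ a b c d → a + b + c + d ≡ a + c + b + d
  swap = solve-∀
  antisymmetric : ∀ a₁ a₂ b₁ b₂ c₁ c₂ →
    (c₁ - a₁) * (b₂ - a₂) - (b₁ - a₁) * (c₂ - a₂) ≡
    - ((b₁ - a₁) * (c₂ - a₂) - (c₁ - a₁) * (b₂ - a₂))
  antisymmetric = solve-∀

ZeroSumOddArea-centroid₄ : Odd (det (q ⊖ p) (e ⊖ p)) → ZeroSumOddArea p q (apex p q e) e
ZeroSumOddArea-centroid₄ {q₁ , q₂} {p₁ , p₂} {e₁ , e₂} odd = ⟨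
  (divides-by e₁ (sum p₁ q₁ e₁) , divides-by e₂ (sum p₂ q₂ e₂)) ,
  subst Odd (sym (triple p₁ p₂ q₁ q₂ e₁ e₂)) (Odd-* (+ 1 , refl) odd) ⟩
  where
  sum : ∀ p q e → p + q + (+ 3 * e - p - q) + e - + 0 ≡ e * + 4
  sum = solve-∀
  triple : ∀ p₁ p₂ q₁ q₂ e₁ e₂ →
    (q₁ - p₁) * ((+ 3 * e₂ - p₂ - q₂) - p₂) - ((+ 3 * e₁ - p₁ - q₁) - p₁) * (q₂ - p₂) ≡
    + 3 * ((q₁ - p₁) * (e₂ - p₂) - (e₁ - p₁) * (q₂ - p₂))
  triple = solve-∀

ZeroSumOddArea-centroid₃ : Odd (det (q ⊖ p) (e ⊖ p)) → ZeroSumOddArea p q e (apex p q e)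
ZeroSumOddArea-centroid₃ {q₁ , q₂} {p₁ , p₂} {e₁ , e₂} odd =
  ⟨ (divides-by e₁ (sum p₁ q₁ e₁) , divides-by e₂ (sum p₂ q₂ e₂)) , odd ⟩
  where
  sum : ∀ p q e → p + q + e + (+ 3 * e - p - q) - + 0 ≡ e * + 4
  sum = solve-∀

OnlyLatticePoint⇒ZeroSumOddArea₄ : OnlyLatticePoint p q r e → ZeroSumOddArea p q r e
OnlyLatticePoint⇒ZeroSumOddArea₄ t with centroid t
... | refl = ZeroSumOddArea-centroid₄ (area-odd t)

OnlyLatticePoint⇒ZeroSumOddArea₃ : OnlyLatticePoint p q r e → ZeroSumOddArea p q e r
OnlyLatticePoint⇒ZeroSumOddArea₃ t with centroid t
... | refl = ZeroSumOddArea-centroid₃ (area-odd t)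

In3 : ℤ² → ℤ² → ℤ² → ℤ² → Set
In3 a b c x = x ≡ a ⊎ x ≡ b ⊎ x ≡ c

In3-swap₁₂ : In3 a b c x → In3 b a c x
In3-swap₁₂ (inj₁ x≡a) = inj₂ (inj₁ x≡a)
In3-swap₁₂ (inj₂ (inj₁ x≡b)) = inj₁ x≡b
In3-swap₁₂ (inj₂ (inj₂ x≡c)) = inj₂ (inj₂ x≡c)

In3-swap₂₃ : In3 a b c x → In3 a c b x
In3-swap₂₃ (inj₁ x≡a) = inj₁ x≡a
In3-swap₂₃ (inj₂ (inj₁ x≡b)) = inj₂ (inj₂ x≡b)
In3-swap₂₃ (inj₂ (inj₂ x≡c)) = inj₂ (inj₁ x≡c)

In3⇒In4 : In3 a b c x → In4 a b c d x
In3⇒In4 (inj₁ x≡a) = inj₁ x≡a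
In3⇒In4 (inj₂ (inj₁ x≡b)) = inj₂ (inj₁ x≡b)
In3⇒In4 (inj₂ (inj₂ x≡c)) = inj₂ (inj₂ (inj₁ x≡c))

In4-split : In4 a b c d x → In3 a b c x ⊎ x ≡ d
In4-split (inj₁ x≡a) = inj₁ (inj₁ x≡a)
In4-split (inj₂ (inj₁ x≡b)) = inj₁ (inj₂ (inj₁ x≡b))
In4-split (inj₂ (inj₂ (inj₁ x≡c))) = inj₁ (inj₂ (inj₂ x≡c))
In4-split (inj₂ (inj₂ (inj₂ x≡d))) = inj₂ x≡d

In4⇒In3 : In4 a b c d x → x ≢ d → In3 a b c x
In4⇒In3 x∈abcd x≢d with In4-split x∈abcd
... | inj₁ x∈abc = x∈abc
... | inj₂ x≡d = ⊥-elim (x≢d x≡d)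

In3⇒≢ : Distinct4 a b c d → In3 a b c x → x ≢ d
In3⇒≢ (_ , _ , a≢d , _ , _ , _) (inj₁ refl) = a≢d
In3⇒≢ (_ , _ , _ , _ , b≢d , _) (inj₂ (inj₁ refl)) = b≢d
In3⇒≢ (_ , _ , _ , _ , _ , c≢d) (inj₂ (inj₂ refl)) = c≢d

-- (a, b, c) is a rearrangement of (x, y, z), encoded as transport of every property that is
-- invariant under permutations.
Rearrangement : ℤ² → ℤ² → ℤ² → ℤ² → ℤ² → ℤ² → Set₁
Rearrangement x y z a b c = (P : ℤ² → ℤ² → ℤ² → Set) →
  (∀ {u v s} → P u v s → P v u s) → (∀ {u v s} → P u v s → P u s v) → P x y z → P a b c

Rearrangement-In3 : ∀ {z} → Rearrangement x y z a b c → In3 a b c w → In3 x y z w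
Rearrangement-In3 {x} {y} {a} {b} {c} {w} {z} rearrange =
  rearrange (λ u v s → In3 u v s w → In3 x y z w) (_∘ In3-swap₁₂) (_∘ In3-swap₂₃) (λ w∈xyz → w∈xyz)

Rearrangement-In3⁻¹ : ∀ {z} → Rearrangement x y z a b c → In3 x y z w → In3 a b c w
Rearrangement-In3⁻¹ {w = w} rearrange = rearrange (λ u v s → In3 u v s w) In3-swap₁₂ In3-swap₂₃

complete-triple : a ≢ b → a ≢ c → b ≢ c → In3 a b c x → In3 a b c y → x ≢ y →
  ∃[ z ] z ≢ x × z ≢ y × Rearrangement x y z a b c
complete-triple a≢b a≢c b≢c (inj₁ refl) (inj₂ (inj₁ refl)) _ =
  _ , a≢c ∘ sym , b≢c ∘ sym , λ P swap₁₂ swap₂₃ h → h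
complete-triple a≢b a≢c b≢c (inj₁ refl) (inj₂ (inj₂ refl)) _ =
  _ , a≢b ∘ sym , b≢c , λ P swap₁₂ swap₂₃ h → swap₂₃ h
complete-triple a≢b a≢c b≢c (inj₂ (inj₁ refl)) (inj₁ refl) _ =
  _ , b≢c ∘ sym , a≢c ∘ sym , λ P swap₁₂ swap₂₃ h → swap₁₂ h
complete-triple a≢b a≢c b≢c (inj₂ (inj₁ refl)) (inj₂ (inj₂ refl)) _ =
  _ , a≢b , a≢c , λ P swap₁₂ swap₂₃ h → swap₁₂ (swap₂₃ h)
complete-triple a≢b a≢c b≢c (inj₂ (inj₂ refl)) (inj₁ refl) _ =
  _ , b≢c , a≢b ∘ sym , λ P swap₁₂ swap₂₃ h → swap₂₃ (swap₁₂ h)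
complete-triple a≢b a≢c b≢c (inj₂ (inj₂ refl)) (inj₂ (inj₁ refl)) _ =
  _ , a≢c , a≢b , λ P swap₁₂ swap₂₃ h → swap₁₂ (swap₂₃ (swap₁₂ h))
complete-triple _ _ _ (inj₁ refl) (inj₁ refl) x≢y = ⊥-elim (x≢y refl)
complete-triple _ _ _ (inj₂ (inj₁ refl)) (inj₂ (inj₁ refl)) x≢y = ⊥-elim (x≢y refl)
complete-triple _ _ _ (inj₂ (inj₂ refl)) (inj₂ (inj₂ refl)) x≢y = ⊥-elim (x≢y refl)

record VerticesOf (a b c d p q r : ℤ²) : Set where
  field
    nonCollinear : NonCollinear p q r
    latticePoints : ∀ x → InHull p q r x → In4 a b c d x
    interior : ∀ x → In4 a b c d x → x ≢ p → x ≢ q → x ≢ r → InInterior p q r x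

VerticesOf-rotate : VerticesOf a b c d p q r → VerticesOf a b c d q r p
VerticesOf-rotate {p = p} {q} {r} v = record
  { nonCollinear = NonCollinear-rotate {p} {q} {r} nonCollinear
  ; latticePoints = λ x x∈qrp → latticePoints x (InHull-rotate (InHull-rotate x∈qrp))
  ; interior = λ x x∈S x≢q x≢r x≢p → InInterior-rotate (interior x x∈S x≢p x≢q x≢r)
  }
  where open VerticesOf v

complete-vertices : Distinct4 a b c d → VerticesOf a b c d p q r → p ≢ d → q ≢ d →
  ∃[ z ] z ≢ p × z ≢ q × Rearrangement p q z a b c
complete-vertices {p = p} {q} {r} (a≢b , a≢c , _ , b≢c , _ , _) v p≢d q≢d =
  complete-triple a≢b a≢c b≢c
    (In4⇒In3 (latticePoints p InHull-vertex₁) p≢d) (In4⇒In3 (latticePoints q InHull-vertex₂) q≢d)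
    (NonCollinear⇒p≢q {p} {q} {r} nonCollinear)
  where open VerticesOf v

ZeroSumOddArea-vertex-last : Distinct4 a b c d → VerticesOf a b c d p q d → ZeroSumOddArea a b c d
ZeroSumOddArea-vertex-last {a} {b} {c} {d} {p} {q} distinct v
  with complete-vertices distinct v (NonCollinear⇒p≢r {p} {q} {d} (VerticesOf.nonCollinear v))
                                    (NonCollinear⇒q≢r {p} {q} {d} (VerticesOf.nonCollinear v))
... | z , z≢p , z≢q , rearrange = rearrange (λ u v s → ZeroSumOddArea u v s d)
  ZeroSumOddArea-swap₁₂ ZeroSumOddArea-swap₂₃ (OnlyLatticePoint⇒ZeroSumOddArea₃ only-z)
  where
  open VerticesOf v
  z∈abc : In3 a b c z
  z∈abc = Rearrangement-In3⁻¹ rearrange (inj₂ (inj₂ refl))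
  relabel : In4 a b c d x → In4 p q d z x
  relabel x∈S with In4-split x∈S
  ... | inj₂ x≡d = inj₂ (inj₂ (inj₁ x≡d))
  ... | inj₁ x∈abc with Rearrangement-In3 rearrange x∈abc
  ...   | inj₁ x≡p = inj₁ x≡p
  ...   | inj₂ (inj₁ x≡q) = inj₂ (inj₁ x≡q)
  ...   | inj₂ (inj₂ x≡z) = inj₂ (inj₂ (inj₂ x≡z))
  only-z : OnlyLatticePoint p q d z
  only-z = record
    { nonCollinear = nonCollinear
    ; latticePoints = λ x x∈pqd → relabel (latticePoints x x∈pqd)
    ; interior = interior z (In3⇒In4 z∈abc) z≢p z≢q (In3⇒≢ distinct z∈abc)
    }

ZeroSumOddArea-interior-last : Distinct4 a b c d → VerticesOf a b c d p q r →
  d ≢ p → d ≢ q → d ≢ r → ZeroSumOddArea a b c d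
ZeroSumOddArea-interior-last {a} {b} {c} {d} {p} {q} {r} distinct v d≢p d≢q d≢r
  with complete-vertices distinct v (d≢p ∘ sym) (d≢q ∘ sym)
... | z , z≢p , z≢q , rearrange
  with Rearrangement-In3 rearrange
         (In4⇒In3 (VerticesOf.latticePoints v r InHull-vertex₃) (d≢r ∘ sym))
...   | inj₁ r≡p =
  ⊥-elim (NonCollinear⇒p≢r {p} {q} {r} (VerticesOf.nonCollinear v) (sym r≡p))
...   | inj₂ (inj₁ r≡q) =
  ⊥-elim (NonCollinear⇒q≢r {p} {q} {r} (VerticesOf.nonCollinear v) (sym r≡q))
...   | inj₂ (inj₂ refl) = rearrange (λ u v s → ZeroSumOddArea u v s d)
  ZeroSumOddArea-swap₁₂ ZeroSumOddArea-swap₂₃ (OnlyLatticePoint⇒ZeroSumOddArea₄ only-d)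
  where
  open VerticesOf v
  relabel : In4 a b c d x → In4 p q r d x
  relabel x∈S with In4-split x∈S
  ... | inj₂ x≡d = inj₂ (inj₂ (inj₂ x≡d))
  ... | inj₁ x∈abc = In3⇒In4 (Rearrangement-In3 rearrange x∈abc)
  only-d : OnlyLatticePoint p q r d
  only-d = record
    { nonCollinear = nonCollinear
    ; latticePoints = λ x x∈pqr → relabel (latticePoints x x∈pqr)
    ; interior = interior d (inj₂ (inj₂ (inj₂ refl))) d≢p d≢q d≢r
    }

_≟²_ : (x y : ℤ²) → Dec (x ≡ y)
_≟²_ = ≡-dec ℤ._≟_ ℤ._≟_

VerticesOf⇒ZeroSumOddArea : Distinct4 a b c d → VerticesOf a b c d p q r → ZeroSumOddArea a b c d
VerticesOf⇒ZeroSumOddArea {d = d} {p} {q} {r} distinct v with d ≟² p | d ≟² q | d ≟² r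
... | yes refl | _        | _        = ZeroSumOddArea-vertex-last distinct (VerticesOf-rotate v)
... | no _     | yes refl | _        =
  ZeroSumOddArea-vertex-last distinct (VerticesOf-rotate (VerticesOf-rotate v))
... | no _     | no _     | yes refl = ZeroSumOddArea-vertex-last distinct v
... | no d≢p   | no d≢q   | no d≢r   = ZeroSumOddArea-interior-last distinct v d≢p d≢q d≢r

InternalTriangle⇒ZeroSumOddArea : InternalTriangle a b c d → ZeroSumOddArea a b c d
InternalTriangle⇒ZeroSumOddArea
  (distinct , _ , _ , _ , nonCollinear , latticePoints , _ , interior) =
  VerticesOf⇒ZeroSumOddArea distinct
    (record { nonCollinear = nonCollinear ; latticePoints = latticePoints ; interior = interior })

-- Reduction modulo 4

≡₄⇒shift : ∀ x y → x ≡₄ y → ∃[ k ] x ≡ y ⊕ ((+ 4) · k)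
≡₄⇒shift (x₁ , x₂) (y₁ , y₂) (4∣x₁-y₁ , 4∣x₂-y₂)
  with Signed.∣ᵤ⇒∣ {+ 4} {x₁ - y₁} 4∣x₁-y₁ | Signed.∣ᵤ⇒∣ {+ 4} {x₂ - y₂} 4∣x₂-y₂
... | Signed.divides k₁ x₁-y₁≡k₁*4 | Signed.divides k₂ x₂-y₂≡k₂*4 =
  (k₁ , k₂) , cong₂ _,_ (shift x₁-y₁≡k₁*4) (shift x₂-y₂≡k₂*4)
  where
  open ≡-Reasoning
  shift : ∀ {x y k} → x - y ≡ k * + 4 → x ≡ y + + 4 * k
  shift {x} {y} {k} x-y≡k*4 = begin
    x             ≡⟨ solve (x ∷ y ∷ []) ⟩
    y + (x - y)   ≡⟨ cong (λ t → y + t) x-y≡k*4 ⟩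
    y + k * + 4   ≡⟨ cong (λ t → y + t) (ℤ.*-comm k (+ 4)) ⟩
    y + + 4 * k   ∎

ZeroSumOddArea-shift : ∀ A B C D → ZeroSumOddArea a b c d →
  ZeroSumOddArea (a ⊕ ((+ 4) · A)) (b ⊕ ((+ 4) · B)) (c ⊕ ((+ 4) · C)) (d ⊕ ((+ 4) · D))
ZeroSumOddArea-shift {a₁ , a₂} {b₁ , b₂} {c₁ , c₂} {d₁ , d₂} (A₁ , A₂) (B₁ , B₂) (C₁ , C₂) (D₁ , D₂)
  ⟨ (4∣s₁ , 4∣s₂) , odd-area ⟩ =
  ⟨ (sum-shift a₁ b₁ c₁ d₁ A₁ B₁ C₁ D₁ 4∣s₁ , sum-shift a₂ b₂ c₂ d₂ A₂ B₂ C₂ D₂ 4∣s₂) ,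
    Odd-+-even W (det-shift a₁ a₂ b₁ b₂ c₁ c₂ A₁ A₂ B₁ B₂ C₁ C₂) odd-area ⟩
  where
  W : ℤ
  W = + 2 * ((b₁ - a₁) * (C₂ - A₂) + (B₁ - A₁) * (c₂ - a₂)
             - (c₁ - a₁) * (B₂ - A₂) - (C₁ - A₁) * (b₂ - a₂)
             + + 4 * ((B₁ - A₁) * (C₂ - A₂) - (C₁ - A₁) * (B₂ - A₂)))
  sum-shift : ∀ a b c d A B C D → + 4 ∣ a + b + c + d - + 0 →
    + 4 ∣ (a + + 4 * A) + (b + + 4 * B) + (c + + 4 * C) + (d + + 4 * D) - + 0
  sum-shift a b c d A B C D 4∣s =
    Signed.∣⇒∣ᵤ (subst (Signed._∣_ (+ 4)) (sym (regroup a b c d A B C D))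
      (Signed.∣m∣n⇒∣m+n (Signed.∣ᵤ⇒∣ {+ 4} {a + b + c + d - + 0} 4∣s)
                        (Signed.divides (A + B + C + D) refl)))
    where
    regroup : ∀ a b c d A B C D →
      (a + + 4 * A) + (b + + 4 * B) + (c + + 4 * C) + (d + + 4 * D) - + 0 ≡
      (a + b + c + d - + 0) + (A + B + C + D) * + 4
    regroup = solve-∀
  det-shift : ∀ a₁ a₂ b₁ b₂ c₁ c₂ A₁ A₂ B₁ B₂ C₁ C₂ →
    ((b₁ + + 4 * B₁) - (a₁ + + 4 * A₁)) * ((c₂ + + 4 * C₂) - (a₂ + + 4 * A₂)) -
    ((c₁ + + 4 * C₁) - (a₁ + + 4 * A₁)) * ((b₂ + + 4 * B₂) - (a₂ + + 4 * A₂)) ≡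
    + 2 * (+ 2 * ((b₁ - a₁) * (C₂ - A₂) + (B₁ - A₁) * (c₂ - a₂)
                  - (c₁ - a₁) * (B₂ - A₂) - (C₁ - A₁) * (b₂ - a₂)
                  + + 4 * ((B₁ - A₁) * (C₂ - A₂) - (C₁ - A₁) * (B₂ - A₂))))
    + ((b₁ - a₁) * (c₂ - a₂) - (c₁ - a₁) * (b₂ - a₂))
  det-shift = solve-∀

ZeroSumOddArea-≡₄ : ∀ a₀ b₀ c₀ d₀ → a₀ ≡₄ a → b₀ ≡₄ b → c₀ ≡₄ c → d₀ ≡₄ d →
  ZeroSumOddArea a b c d → ZeroSumOddArea a₀ b₀ c₀ d₀
ZeroSumOddArea-≡₄ {a} {b} {c} {d} a₀ b₀ c₀ d₀ a₀≡a b₀≡b c₀≡c d₀≡d z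
  with ≡₄⇒shift a₀ a a₀≡a | ≡₄⇒shift b₀ b b₀≡b | ≡₄⇒shift c₀ c c₀≡c | ≡₄⇒shift d₀ d d₀≡d
... | A , refl | B , refl | C , refl | D , refl = ZeroSumOddArea-shift A B C D z

Odd⇒≡±1 : ∀ {o} → Odd o → + 4 ∣ o - + 1 ⊎ + 4 ∣ o + + 1
Odd⇒≡±1 (k , refl) with parity k
... | j , _ , inj₁ refl , refl = inj₁ (divides-by j (≡1 j))
  where
  ≡1 : ∀ j → + 2 * (+ 2 * j + + 0) + + 1 - + 1 ≡ j * + 4
  ≡1 = solve-∀
... | j , _ , inj₂ refl , refl = inj₂ (divides-by (j + + 1) (≡-1 j))
  where
  ≡-1 : ∀ j → + 2 * (+ 2 * j + + 1) + + 1 + + 1 ≡ (j + + 1) * + 4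
  ≡-1 = solve-∀

lemma4p7 : (a b c d a₀ b₀ c₀ d₀ : ℤ²) → InternalTriangle a b c d
    → a₀ ≡₄ a → b₀ ≡₄ b → c₀ ≡₄ c → d₀ ≡₄ d
    → ((((a₀ ⊕ b₀) ⊕ c₀) ⊕ d₀) ≡₄ (+ 0 , + 0))
      × (((+ 4) ∣ (det (b₀ ⊖ a₀) (c₀ ⊖ a₀) - + 1))
         ⊎ ((+ 4) ∣ (det (b₀ ⊖ a₀) (c₀ ⊖ a₀) + + 1)))
lemma4p7 a b c d a₀ b₀ c₀ d₀ internal a₀≡a b₀≡b c₀≡c d₀≡d
  with ZeroSumOddArea-≡₄ a₀ b₀ c₀ d₀ a₀≡a b₀≡b c₀≡c d₀≡d (InternalTriangle⇒ZeroSumOddArea internal)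
... | ⟨ zero-sum , odd-area ⟩ = zero-sum , Odd⇒≡±1 odd-area
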